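{- Let $n$ and $d$ be positive integers, let $\mathcal{T}(d,n)$ be the set of width-one $n\times n$ matrices with nonnegative integer entries summing to $d$, and let $\mathbf{S}(d,n)=\sum_{T\in\mathcal{T}(d,n)} T$. Then for all $1\le i,j\le n$, \[ \mathbf{S}(d,n)_{ij}=\binom{i+d-2}{d-1}\binom{j+d-2}{d-1}\,{}_4F_3\!\left[\begin{matrix} n-i+1,\; n-j+1,\; 1-d,\; 1-d\\ 1,\; 2-d-i,\; 2-d-j\end{matrix}\,;\,1\right]. \]
   Context: Equip $\Pi_n=\{(x,y):1\le x,y\le n\}$ with the product order $(x,y)\preceq(x',y')$ iff $x\le x'$ and $y\le y'$. The support of an $n\times n$ matrix $M$ is $\{(i,j): M_{ij}\neq 0\}$; $M$ is width-one if its support is a chain in $\Pi_n$ (i.e., the largest antichain in the support has size at most 1; equivalently the nonzero entries lie along a path of south and east steps). The generalized hypergeometric series is the formal series ${}_pF_q\!\left[\begin{smallmatrix}a_1,\dots,a_p\\ b_1,\dots,b_q\end{smallmatrix};z\right]=\sum_{k\ge0}\frac{(a_1)_k\cdots(a_p)_k}{(b_1)_k\cdots(b_q)_k}\frac{z^k}{k!}$, where $(a)_k=a(a+1)\cdots(a+k-1)$ is the rising factorial; when an upper parameter is a nonpositive integer $-m$ the series terminates after the $k=m$ term (here the sum runs over $0\le k\le d-1$, and the lower parameters give nonzero denominators in that range). -}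

module Defs where

open import Data.Nat as ℕ using (ℕ; zero; suc)
open import Data.Nat.Combinatorics using (_C_)
open import Data.Integer as ℤ using (ℤ; +_)
open import Data.Rational as ℚ using (ℚ; 0ℚ; 1ℚ; _/_)
open import Data.Rational.Properties using (_≟_)
open import Data.Fin as Fin using (Fin; toℕ)
open import Data.Vec as Vec using (Vec; lookup)
open import Data.List as List using (List; upTo)
open import Data.Product using (_×_)
open import Data.Sum using (_⊎_)
open import Relation.Nullary using (yes; no; ¬_)
open import Relation.Binary.PropositionalEquality using (_≡_)

Mat : ℕ → Set
Mat n = Vec (Vec ℕ n) n

entry : ∀ {n} → Mat n → Fin n → Fin n → ℕ
entry M a b = lookup (lookup M a) b

total : ∀ {n} → Mat n → ℕ
total M = Vec.sum (Vec.map Vec.sum M)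

-- support is a chain in the product order on Π_n
WidthOne : ∀ {n} → Mat n → Set
WidthOne {n} M = ∀ (a b c e : Fin n) → ¬ (entry M a b ≡ 0) → ¬ (entry M c e ≡ 0) →
  ((a Fin.≤ c) × (b Fin.≤ e)) ⊎ ((c Fin.≤ a) × (e Fin.≤ b))

InT : (d n : ℕ) → Mat n → Set
InT d n M = WidthOne M × (total M ≡ d)

ℤ→ℚ : ℤ → ℚ
ℤ→ℚ z = z / 1

ℕ→ℚ : ℕ → ℚ
ℕ→ℚ k = ℤ→ℚ (+ k)

-- division, with the (unused here) convention p ÷' 0 = 0
_÷'_ : ℚ → ℚ → ℚ
p ÷' q with q ≟ 0ℚ
... | yes _ = 0ℚ
... | no q≢0 = ℚ._÷_ p q {{ℚ.≢-nonZero q≢0}}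

poch : ℚ → ℕ → ℚ
poch a zero = 1ℚ
poch a (suc k) = poch a k ℚ.* (a ℚ.+ ℕ→ℚ k)

term43 : ℚ → ℚ → ℚ → ℚ → ℚ → ℚ → ℚ → ℚ → ℕ → ℚ
term43 a1 a2 a3 a4 b1 b2 b3 z k =
  ((poch a1 k ℚ.* poch a2 k ℚ.* poch a3 k ℚ.* poch a4 k) ℚ.* pow z k)
    ÷' (poch b1 k ℚ.* poch b2 k ℚ.* poch b3 k ℚ.* poch 1ℚ k)
  where
  pow : ℚ → ℕ → ℚ
  pow x zero = 1ℚ
  pow x (suc m) = pow x m ℚ.* x

-- the terminating 4F3, summed over 0 ≤ k ≤ d-1 (i.e. k ∈ upTo d)
F43 : ℕ → ℚ → ℚ → ℚ → ℚ → ℚ → ℚ → ℚ → ℚ → ℚ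
F43 d a1 a2 a3 a4 b1 b2 b3 z =
  List.foldr ℚ._+_ 0ℚ (List.map (term43 a1 a2 a3 a4 b1 b2 b3 z) (upTo d))

-- right-hand side, for 1-based indices i j
rhs : (d n i j : ℕ) → ℚ
rhs d n i j =
  ℕ→ℚ (((i ℕ.+ d) ℕ.∸ 2) C (d ℕ.∸ 1)) ℚ.* ℕ→ℚ (((j ℕ.+ d) ℕ.∸ 2) C (d ℕ.∸ 1)) ℚ.*
  F43 d (ℤ→ℚ (+ n ℤ.- + i ℤ.+ + 1)) (ℤ→ℚ (+ n ℤ.- + j ℤ.+ + 1))
        (ℤ→ℚ (+ 1 ℤ.- + d)) (ℤ→ℚ (+ 1 ℤ.- + d))
        1ℚ (ℤ→ℚ (+ 2 ℤ.- + d ℤ.- + i)) (ℤ→ℚ (+ 2 ℤ.- + d ℤ.- + j)) 1ℚ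

-- A width-one matrix of total d is the sum of the unit matrices at a multichain
-- p₁ ⪯ ⋯ ⪯ p_d of Π_n; choosing the least point first and recursing enumerates 𝒯(d,n)
-- without repetition. Writing p_t = (x_t, y_t), the sequences x and y range independently
-- over the nondecreasing sequences of length d, and the (i,j) entry counts the t with
-- x_t = i and y_t = j. Hence S(d,n)_ij = Σ_{t<d} h_i(t) h_j(t), where by the hockey-stick
-- identity h_i(t) = C(i-1+t, t) C(n-i+d-1-t, d-1-t) counts the nondecreasing sequences
-- with x_t = i. For t = d-1-k, the identities (n-i+1)_k = k! C(n-i+k, k) and
-- C(i+d-2, d-1) (1-d)_k = C(i-1+t, t) (2-d-i)_k turn this summand into the prefactor
-- times the k-th term of the 4F3 series.

module Submission where

open import Defs
open import Data.Nat using (ℕ; _≥_; suc)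
open import Data.Fin using (Fin; toℕ; zero)
import Data.Fin.Properties as Fin
open import Data.List using (List; map)
open import Data.Nat.ListAction using (sum)
open import Data.List.Membership.Propositional using (_∈_)
open import Data.List.Relation.Unary.Unique.Propositional using (Unique)
open import Function.Bundles using (_⇔_)
import Function.Properties.Equivalence as ⇔
open import Relation.Binary.PropositionalEquality using (_≡_; cong; module ≡-Reasoning)

module Sums where
  open import Data.Nat
  open import Data.Nat.Properties
  open import Data.Nat.Tactic.RingSolver using (solve-∀)
  open import Data.List using (List; []; _∷_; _++_; map; concatMap; applyUpTo; length)
  open import Data.List.Properties using (map-cong; map-++; length-++)
  open import Data.Nat.ListAction.Properties using (sum-++; sum-↭)
  open import Function using (_∘_)
  open import Data.List.Membership.Propositional.Properties.WithK using (unique∧set⇒bag)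
  open import Data.List.Relation.Binary.BagAndSetEquality using (∼bag⇒↭)
  import Data.List.Relation.Binary.Permutation.Propositional.Properties as ↭
  open import Relation.Binary.PropositionalEquality

  private variable
    A B : Set

  sum-map-Unique-cong : ∀ (f : A → ℕ) {xs ys} → Unique xs → Unique ys → (∀ z → (z ∈ xs) ⇔ (z ∈ ys)) →
    sum (map f xs) ≡ sum (map f ys)
  sum-map-Unique-cong f xs! ys! same = sum-↭ (↭.map⁺ f (∼bag⇒↭ (unique∧set⇒bag xs! ys! λ {z} → same z)))

  applyUpTo-cong : ∀ {f g : ℕ → A} L → (∀ k → k < L → f k ≡ g k) → applyUpTo f L ≡ applyUpTo g L
  applyUpTo-cong zero eq = refl
  applyUpTo-cong (suc L) eq = cong₂ _∷_ (eq 0 z<s) (applyUpTo-cong L (λ k k<L → eq (suc k) (s<s k<L)))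

  sum-applyUpTo-zero : ∀ L → sum (applyUpTo (λ _ → 0) L) ≡ 0
  sum-applyUpTo-zero zero = refl
  sum-applyUpTo-zero (suc L) = sum-applyUpTo-zero L

  sum-applyUpTo-snoc : ∀ f L → sum (applyUpTo f (suc L)) ≡ sum (applyUpTo f L) + f L
  sum-applyUpTo-snoc f zero = +-comm (f 0) 0
  sum-applyUpTo-snoc f (suc L) =
    trans (cong (f 0 +_) (sum-applyUpTo-snoc (λ k → f (suc k)) L)) (sym (+-assoc (f 0) _ _))

  sum-applyUpTo-reverse : ∀ f L → sum (applyUpTo f L) ≡ sum (applyUpTo (λ k → f (L ∸ suc k)) L)
  sum-applyUpTo-reverse f zero = refl
  sum-applyUpTo-reverse f (suc L) = begin
    sum (applyUpTo f (suc L))                              ≡⟨ sum-applyUpTo-snoc f L ⟩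
    sum (applyUpTo f L) + f L                              ≡⟨ +-comm (sum (applyUpTo f L)) (f L) ⟩
    f L + sum (applyUpTo f L)                              ≡⟨ cong (f L +_) (sum-applyUpTo-reverse f L) ⟩
    f L + sum (applyUpTo (λ k → f (L ∸ suc k)) L)          ∎
    where open ≡-Reasoning

  sum-map-cong : ∀ {f g : A → ℕ} xs → (∀ x → f x ≡ g x) → sum (map f xs) ≡ sum (map g xs)
  sum-map-cong xs eq = cong sum (map-cong eq xs)

  sum-map-+ : ∀ (f g : A → ℕ) xs → sum (map (λ x → f x + g x) xs) ≡ sum (map f xs) + sum (map g xs)
  sum-map-+ f g [] = refl
  sum-map-+ f g (x ∷ xs) = trans (cong (f x + g x +_) (sum-map-+ f g xs)) (interchange (f x) (g x) _ _)
    where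
    interchange : ∀ a b c d → a + b + (c + d) ≡ a + c + (b + d)
    interchange = solve-∀

  sum-map-*ˡ : ∀ c (f : A → ℕ) xs → sum (map (λ x → c * f x) xs) ≡ c * sum (map f xs)
  sum-map-*ˡ c f [] = sym (*-zeroʳ c)
  sum-map-*ˡ c f (x ∷ xs) = trans (cong (c * f x +_) (sum-map-*ˡ c f xs)) (sym (*-distribˡ-+ c (f x) _))

  sum-map-*ʳ : ∀ c (f : A → ℕ) xs → sum (map (λ x → f x * c) xs) ≡ sum (map f xs) * c
  sum-map-*ʳ c f [] = refl
  sum-map-*ʳ c f (x ∷ xs) = trans (cong (f x * c +_) (sum-map-*ʳ c f xs)) (sym (*-distribʳ-+ c (f x) _))

  sum-map-product : ∀ (f : A → ℕ) (g : B → ℕ) xs ys →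
    sum (map (λ x → sum (map (λ y → f x * g y) ys)) xs) ≡ sum (map f xs) * sum (map g ys)
  sum-map-product f g xs ys =
    trans (sum-map-cong xs (λ x → sum-map-*ˡ (f x) g ys)) (sum-map-*ʳ (sum (map g ys)) f xs)

  sum-concatMap : ∀ (f : B → ℕ) (g : A → List B) xs →
    sum (map f (concatMap g xs)) ≡ sum (map (λ x → sum (map f (g x))) xs)
  sum-concatMap f g [] = refl
  sum-concatMap f g (x ∷ xs) = begin
    sum (map f (g x ++ concatMap g xs))               ≡⟨ cong sum (map-++ f (g x) (concatMap g xs)) ⟩
    sum (map f (g x) ++ map f (concatMap g xs))       ≡⟨ sum-++ (map f (g x)) _ ⟩
    sum (map f (g x)) + sum (map f (concatMap g xs))            ≡⟨ cong (sum (map f (g x)) +_) (sum-concatMap f g xs) ⟩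
    sum (map f (g x)) + sum (map (λ x → sum (map f (g x))) xs)  ∎
    where open ≡-Reasoning

  length-concatMap : ∀ (g : A → List B) xs → length (concatMap g xs) ≡ sum (map (length ∘ g) xs)
  length-concatMap g [] = refl
  length-concatMap g (x ∷ xs) = trans (length-++ (g x)) (cong (length (g x) +_) (length-concatMap g xs))

  sum-map-const : ∀ c (xs : List A) → sum (map (λ _ → c) xs) ≡ c * length xs
  sum-map-const c [] = sym (*-zeroʳ c)
  sum-map-const c (x ∷ xs) = trans (cong (c +_) (sum-map-const c xs)) (sym (*-suc c (length xs)))

  sum-map-sum-applyUpTo : ∀ (F : ℕ → A → ℕ) L xs →
    sum (map (λ x → sum (applyUpTo (λ t → F t x) L)) xs) ≡ sum (applyUpTo (λ t → sum (map (F t) xs)) L)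
  sum-map-sum-applyUpTo F zero xs = sum-map-zero xs
    where
    sum-map-zero : ∀ (xs : List A) → sum (map (λ _ → 0) xs) ≡ 0
    sum-map-zero [] = refl
    sum-map-zero (x ∷ xs) = sum-map-zero xs
  sum-map-sum-applyUpTo F (suc L) xs = trans (sum-map-+ (F 0) (λ x → sum (applyUpTo (λ t → F (suc t) x) L)) xs)
    (cong (sum (map (F 0) xs) +_) (sum-map-sum-applyUpTo (λ t → F (suc t)) L xs))

module Binomials where
  open import Data.Nat
  open import Data.Nat.Properties
  open import Data.Nat.Combinatorics using (_C_; nCn≡1; nCk+nC[k+1]≡[n+1]C[k+1])
  open import Data.Nat.Tactic.RingSolver using (solve-∀)
  open import Data.List using (applyUpTo)
  open import Data.Sum using (inj₂)
  open Sums using (sum-applyUpTo-zero)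
  open import Relation.Binary.PropositionalEquality
  open ≡-Reasoning

  paths : ℕ → ℕ → ℕ
  paths zero b = 1
  paths (suc a) zero = 1
  paths (suc a) (suc b) = paths a (suc b) + paths (suc a) b

  paths-zeroʳ : ∀ a → paths a 0 ≡ 1
  paths-zeroʳ zero = refl
  paths-zeroʳ (suc a) = refl

  paths≡C : ∀ a b → paths a b ≡ (a + b) C b
  paths≡C zero b = sym (nCn≡1 b)
  paths≡C (suc a) zero = refl
  paths≡C (suc a) (suc b) = begin
    paths a (suc b) + paths (suc a) b      ≡⟨ cong₂ _+_ (paths≡C a (suc b)) (paths≡C (suc a) b) ⟩
    (a + suc b) C suc b + (suc a + b) C b  ≡⟨ cong (λ m → m C suc b + (suc a + b) C b) (+-suc a b) ⟩
    (suc a + b) C suc b + (suc a + b) C b  ≡⟨ +-comm ((suc a + b) C suc b) _ ⟩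
    (suc a + b) C b + (suc a + b) C suc b  ≡⟨ nCk+nC[k+1]≡[n+1]C[k+1] (suc a + b) b ⟩
    suc (suc a + b) C suc b                ≡⟨ cong (λ m → suc m C suc b) (+-suc a b) ⟨
    (suc a + suc b) C suc b                ∎

  paths*factorials : ∀ a b → paths a b * (a ! * b !) ≡ (a + b) !
  paths*factorials zero b = trans (+-identityʳ (b ! + 0)) (+-identityʳ (b !))
  paths*factorials (suc a) zero = trans (+-identityʳ _) (trans (*-identityʳ _) (cong _! (sym (+-identityʳ (suc a)))))
  paths*factorials (suc a) (suc b) = begin
    (paths a (suc b) + paths (suc a) b) * (suc a ! * suc b !)
      ≡⟨ regroup (paths a (suc b)) (paths (suc a) b) (a !) (b !) a b ⟩
    suc a * (paths a (suc b) * (a ! * suc b !)) + suc b * (paths (suc a) b * (suc a ! * b !))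
      ≡⟨ cong₂ (λ x y → suc a * x + suc b * y) (paths*factorials a (suc b)) (paths*factorials (suc a) b) ⟩
    suc a * (a + suc b) ! + suc b * (suc a + b) !
      ≡⟨ cong (λ m → suc a * m ! + suc b * (suc a + b) !) (+-suc a b) ⟩
    suc a * (suc a + b) ! + suc b * (suc a + b) !
      ≡⟨ *-distribʳ-+ ((suc a + b) !) (suc a) (suc b) ⟨
    (suc a + suc b) * (suc a + b) !
      ≡⟨ cong (λ m → (suc a + suc b) * m !) (+-suc a b) ⟨
    (suc a + suc b) ! ∎
    where
    regroup : ∀ p q fa fb a b → (p + q) * ((suc a * fa) * (suc b * fb)) ≡
              suc a * (p * (fa * (suc b * fb))) + suc b * (q * ((suc a * fa) * fb))
    regroup = solve-∀

  falling : ℕ → ℕ → ℕ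
  falling x zero = 1
  falling zero (suc k) = 0
  falling (suc x) (suc k) = suc x * falling x k

  falling*factorial : ∀ y k → falling (y + k) k * y ! ≡ (y + k) !
  falling*factorial y zero = trans (+-identityʳ (y !)) (cong _! (sym (+-identityʳ y)))
  falling*factorial y (suc k) rewrite +-suc y k =
    trans (*-assoc (suc (y + k)) (falling (y + k) k) (y !)) (cong (suc (y + k) *_) (falling*factorial y k))

  falling≢0 : ∀ {x k} → k ≤ x → falling x k ≢ 0
  falling≢0 {k = zero} _ ()
  falling≢0 {suc x} {suc k} (s≤s k≤x) eq with m*n≡0⇒m≡0∨n≡0 (suc x) eq
  ... | inj₂ eq′ = falling≢0 k≤x eq′

  paths*falling : ∀ i t k → paths i (t + k) * falling (t + k) k ≡ paths i t * falling (t + k + i) k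
  paths*falling i t k = *-cancelʳ-≡ _ _ (i ! * t !) {{m*n≢0 (i !) (t !) {{i !≢0}} {{t !≢0}}}} (begin
    paths i (t + k) * falling (t + k) k * (i ! * t !)
      ≡⟨ regroupˡ (paths i (t + k)) (falling (t + k) k) (i !) (t !) ⟩
    paths i (t + k) * (i ! * (falling (t + k) k * t !))
      ≡⟨ cong (λ m → paths i (t + k) * (i ! * m)) (falling*factorial t k) ⟩
    paths i (t + k) * (i ! * (t + k) !)
      ≡⟨ paths*factorials i (t + k) ⟩
    (i + (t + k)) !
      ≡⟨ cong _! (+-assoc i t k) ⟨
    (i + t + k) !
      ≡⟨ falling*factorial (i + t) k ⟨
    falling (i + t + k) k * (i + t) !
      ≡⟨ cong (λ m → falling m k * (i + t) !) (rotate i t k) ⟩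
    falling (t + k + i) k * (i + t) !
      ≡⟨ cong (falling (t + k + i) k *_) (paths*factorials i t) ⟨
    falling (t + k + i) k * (paths i t * (i ! * t !))
      ≡⟨ regroupʳ (falling (t + k + i) k) (paths i t) (i ! * t !) ⟩
    paths i t * falling (t + k + i) k * (i ! * t !) ∎)
    where
    regroupˡ : ∀ p f a b → p * f * (a * b) ≡ p * (a * (f * b))
    regroupˡ = solve-∀
    regroupʳ : ∀ f p x → f * (p * x) ≡ p * f * x
    regroupʳ = solve-∀
    rotate : ∀ i t k → i + t + k ≡ t + k + i
    rotate = solve-∀

  rising : ℕ → ℕ → ℕ
  rising x zero = 1
  rising x (suc k) = rising x k * (x + k)

  rising*factorial : ∀ m k → rising (suc m) k * m ! ≡ (m + k) !
  rising*factorial m zero = trans (+-identityʳ (m !)) (cong _! (sym (+-identityʳ m)))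
  rising*factorial m (suc k) = begin
    rising (suc m) k * (suc m + k) * m !    ≡⟨ swap (rising (suc m) k) (suc m + k) (m !) ⟩
    (suc m + k) * (rising (suc m) k * m !)  ≡⟨ cong ((suc m + k) *_) (rising*factorial m k) ⟩
    (suc m + k) * (m + k) !                 ≡⟨ cong _! (+-suc m k) ⟨
    (m + suc k) !                           ∎
    where
    swap : ∀ a b c → a * b * c ≡ b * (a * c)
    swap = solve-∀

  rising≡paths*factorial : ∀ m k → rising (suc m) k ≡ paths m k * k !
  rising≡paths*factorial m k = *-cancelʳ-≡ _ _ (m !) {{m !≢0}} (begin
    rising (suc m) k * m !         ≡⟨ rising*factorial m k ⟩
    (m + k) !                      ≡⟨ paths*factorials m k ⟨
    paths m k * (m ! * k !)        ≡⟨ regroup (paths m k) (m !) (k !) ⟩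
    paths m k * k ! * m !          ∎)
    where
    regroup : ∀ p a b → p * (a * b) ≡ p * b * a
    regroup = solve-∀

  between : ℕ → ℕ → ℕ → ℕ
  between zero i t = paths i t
  between (suc a) zero t = 0
  between (suc a) (suc i) t = between a i t

  between-≤ : ∀ {a i} t → a ≤ i → between a i t ≡ paths (i ∸ a) t
  between-≤ t z≤n = refl
  between-≤ t (s≤s a≤i) = between-≤ t a≤i

  between-> : ∀ {a i} t → i < a → between a i t ≡ 0
  between-> {suc a} {zero} t _ = refl
  between-> {suc a} {suc i} t (s≤s i<a) = between-> t i<a

  hockey-stick : ∀ a {i} L t → i < a + L →
    sum (applyUpTo (λ k → between (a + k) i t) L) ≡ between a i (suc t)
  hockey-stick zero {zero} (suc L) t _ = cong suc (sum-applyUpTo-zero L)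
  hockey-stick zero {suc i} (suc L) t (s≤s i<L) = begin
    paths (suc i) t + sum (applyUpTo (λ k → between k i t) L)  ≡⟨ cong (paths (suc i) t +_) (hockey-stick zero L t i<L) ⟩
    paths (suc i) t + paths i (suc t)                          ≡⟨ +-comm (paths (suc i) t) _ ⟩
    paths (suc i) (suc t)                                      ∎
  hockey-stick (suc a) {zero} L t _ = sum-applyUpTo-zero L
  hockey-stick (suc a) {suc i} L t (s≤s i<a+L) = hockey-stick a L t i<a+L

module Matrices where
  open import Data.Nat as ℕ using (ℕ; zero; suc; _+_; _*_; _≤_; pred)
  open import Data.Nat.Properties hiding (_≟_)
  open import Data.Fin as Fin using (Fin; _≟_)
  open import Data.Vec as Vec using (Vec; lookup; updateAt; _∷_; [])
  open import Data.Vec.Properties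
    using (lookup∘updateAt; lookup∘updateAt′; tabulate∘lookup; tabulate-cong; lookup-map; lookup-replicate; map-replicate)
  open import Data.Product using (_,_; proj₁; proj₂; ∃; ∃₂)
  open import Data.Product.Properties using () renaming (≡-dec to ×-≡-dec)
  open import Data.Sum using (_⊎_; inj₁; inj₂)
  open import Data.Empty using (⊥-elim)
  open import Relation.Nullary using (yes; no)
  open import Relation.Binary.PropositionalEquality

  private variable
    n : ℕ

  modify : (ℕ → ℕ) → Fin n → Fin n → Mat n → Mat n
  modify f x y M = updateAt M x (λ row → updateAt row y f)

  inc dec : Fin n → Fin n → Mat n → Mat n
  inc = modify suc
  dec = modify pred

  entry-modify-≡ : ∀ f (x y : Fin n) M → entry (modify f x y M) x y ≡ f (entry M x y)
  entry-modify-≡ f x y M rewrite lookup∘updateAt x {λ row → updateAt row y f} M = lookup∘updateAt y (lookup M x)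

  entry-modify-≢ : ∀ f {x y a b : Fin n} M → (x , y) ≢ (a , b) → entry (modify f x y M) a b ≡ entry M a b
  entry-modify-≢ f {x} {y} {a} {b} M xy≢ab with x ≟ a
  ... | no x≢a rewrite lookup∘updateAt′ a x {λ row → updateAt row y f} (λ a≡x → x≢a (sym a≡x)) M = refl
  ... | yes refl rewrite lookup∘updateAt x {λ row → updateAt row y f} M =
    lookup∘updateAt′ b y (λ b≡y → xy≢ab (cong (x ,_) (sym b≡y))) (lookup M x)

  lookup-ext : ∀ {A : Set} {m} {u v : Vec A m} → (∀ a → lookup u a ≡ lookup v a) → u ≡ v
  lookup-ext {u = u} {v} eq = trans (sym (tabulate∘lookup u)) (trans (tabulate-cong eq) (tabulate∘lookup v))

  Mat-ext : ∀ (M N : Mat n) → (∀ a b → entry M a b ≡ entry N a b) → M ≡ N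
  Mat-ext M N eq = lookup-ext (λ a → lookup-ext (eq a))

  δ : Fin n → Fin n → ℕ
  δ x a with x ≟ a
  ... | yes _ = 1
  ... | no _ = 0

  δ-refl : ∀ (x : Fin n) → δ x x ≡ 1
  δ-refl x with x ≟ x
  ... | yes _ = refl
  ... | no x≢x = ⊥-elim (x≢x refl)

  δ-≢ : ∀ {x a : Fin n} → x ≢ a → δ x a ≡ 0
  δ-≢ {x = x} {a} x≢a with x ≟ a
  ... | yes x≡a = ⊥-elim (x≢a x≡a)
  ... | no _ = refl

  entry-inc : ∀ (x y : Fin n) M a b → entry (inc x y M) a b ≡ entry M a b + δ x a * δ y b
  entry-inc x y M a b with x ≟ a | y ≟ b
  ... | yes refl | yes refl = trans (entry-modify-≡ suc x y M) (+-comm 1 (entry M x y))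
  ... | yes refl | no y≢b =
    trans (entry-modify-≢ suc M (λ xy≡xb → y≢b (cong proj₂ xy≡xb))) (sym (+-identityʳ (entry M x b)))
  ... | no x≢a | _ =
    trans (entry-modify-≢ suc M (λ xy≡ab → x≢a (cong proj₁ xy≡ab))) (sym (+-identityʳ (entry M a b)))

  total-inc : ∀ (x y : Fin n) M → total (inc x y M) ≡ suc (total M)
  total-inc {n} x y M = rows M x
    where
    sum-updateAt-suc : ∀ {m} (v : Vec ℕ m) i → Vec.sum (updateAt v i suc) ≡ suc (Vec.sum v)
    sum-updateAt-suc (a ∷ v) Fin.zero = refl
    sum-updateAt-suc (a ∷ v) (Fin.suc i) = trans (cong (a +_) (sum-updateAt-suc v i)) (+-suc a _)
    rows : ∀ {m} (M : Vec (Vec ℕ n) m) i →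
      Vec.sum (Vec.map Vec.sum (updateAt M i (λ row → updateAt row y suc))) ≡ suc (Vec.sum (Vec.map Vec.sum M))
    rows (row ∷ M) Fin.zero = cong (_+ Vec.sum (Vec.map Vec.sum M)) (sum-updateAt-suc row y)
    rows (row ∷ M) (Fin.suc i) = trans (cong (Vec.sum row +_) (rows M i)) (+-suc _ _)

  entry≤total : ∀ (M : Mat n) a b → entry M a b ≤ total M
  entry≤total M a b = begin
    entry M a b                          ≤⟨ lookup≤sum (lookup M a) b ⟩
    Vec.sum (lookup M a)                 ≡⟨ lookup-map a Vec.sum M ⟨
    lookup (Vec.map Vec.sum M) a         ≤⟨ lookup≤sum (Vec.map Vec.sum M) a ⟩
    total M                              ∎
    where
    open ≤-Reasoning
    lookup≤sum : ∀ {m} (v : Vec ℕ m) i → lookup v i ≤ Vec.sum v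
    lookup≤sum (a ∷ v) Fin.zero = m≤m+n a _
    lookup≤sum (a ∷ v) (Fin.suc i) = ≤-trans (lookup≤sum v i) (m≤n+m _ a)

  sum≢0⇒lookup≢0 : ∀ {m} (v : Vec ℕ m) → Vec.sum v ≢ 0 → ∃ λ i → lookup v i ≢ 0
  sum≢0⇒lookup≢0 [] sum≢0 = ⊥-elim (sum≢0 refl)
  sum≢0⇒lookup≢0 (zero ∷ v) sum≢0 with sum≢0⇒lookup≢0 v sum≢0
  ... | i , vi≢0 = Fin.suc i , vi≢0
  sum≢0⇒lookup≢0 (suc a ∷ v) _ = Fin.zero , λ ()

  total≢0⇒entry≢0 : ∀ (M : Mat n) → total M ≢ 0 → ∃₂ λ a b → entry M a b ≢ 0
  total≢0⇒entry≢0 M total≢0 with sum≢0⇒lookup≢0 (Vec.map Vec.sum M) total≢0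
  ... | a , rowsum≢0 with sum≢0⇒lookup≢0 (lookup M a) (λ eq → rowsum≢0 (trans (lookup-map a Vec.sum M) eq))
  ...   | b , entry≢0 = a , b , entry≢0

  zeroMat : Mat n
  zeroMat = Vec.replicate _ (Vec.replicate _ 0)

  entry-zeroMat : ∀ (a b : Fin n) → entry zeroMat a b ≡ 0
  entry-zeroMat {n} a b = trans (cong (λ row → lookup row b) (lookup-replicate a (Vec.replicate n 0))) (lookup-replicate b 0)

  total-zeroMat : total (zeroMat {n}) ≡ 0
  total-zeroMat {n} = begin
    Vec.sum (Vec.map Vec.sum (Vec.replicate n (Vec.replicate n 0)))   ≡⟨ cong Vec.sum (map-replicate Vec.sum (Vec.replicate n 0) n) ⟩
    Vec.sum (Vec.replicate n (Vec.sum (Vec.replicate n 0)))           ≡⟨ cong (λ s → Vec.sum (Vec.replicate n s)) (sum-zeros n) ⟩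
    Vec.sum (Vec.replicate n 0)                                       ≡⟨ sum-zeros n ⟩
    0                                                                 ∎
    where
    open ≡-Reasoning
    sum-zeros : ∀ m → Vec.sum (Vec.replicate m 0) ≡ 0
    sum-zeros zero = refl
    sum-zeros (suc m) = sum-zeros m

  total≡0⇒zeroMat : ∀ (M : Mat n) → total M ≡ 0 → M ≡ zeroMat
  total≡0⇒zeroMat M total≡0 = Mat-ext M zeroMat λ a b →
    trans (n≤0⇒n≡0 (≤-trans (entry≤total M a b) (≤-reflexive total≡0))) (sym (entry-zeroMat a b))

  inc∘dec : ∀ (x y : Fin n) M → entry M x y ≢ 0 → inc x y (dec x y M) ≡ M
  inc∘dec x y M Mxy≢0 = Mat-ext _ _ λ a b → trans (entry-inc x y (dec x y M) a b) (entries a b)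
    where
    entries : ∀ a b → entry (dec x y M) a b + δ x a * δ y b ≡ entry M a b
    entries a b with x ≟ a | y ≟ b
    ... | yes refl | yes refl = begin
      entry (dec x y M) x y + 1     ≡⟨ cong (_+ 1) (entry-modify-≡ pred x y M) ⟩
      pred (entry M x y) + 1        ≡⟨ +-comm _ 1 ⟩
      suc (pred (entry M x y))      ≡⟨ suc-pred (entry M x y) {{ℕ.≢-nonZero Mxy≢0}} ⟩
      entry M x y                   ∎
      where open ≡-Reasoning
    ... | yes refl | no y≢b = trans (+-identityʳ _) (entry-modify-≢ pred M (λ xy≡xb → y≢b (cong proj₂ xy≡xb)))
    ... | no x≢a | _ = trans (+-identityʳ _) (entry-modify-≢ pred M (λ xy≡ab → x≢a (cong proj₁ xy≡ab)))

  inc-injective : ∀ (x y : Fin n) {M N} → inc x y M ≡ inc x y N → M ≡ N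
  inc-injective x y {M} {N} eq = Mat-ext M N λ a b → +-cancelʳ-≡ (δ x a * δ y b) _ _
    (trans (sym (entry-inc x y M a b)) (trans (cong (λ L → entry L a b) eq) (entry-inc x y N a b)))

  entry-inc-≢0 : ∀ (x y : Fin n) M → entry (inc x y M) x y ≢ 0
  entry-inc-≢0 x y M eq with trans (sym (entry-modify-≡ suc x y M)) eq
  ... | ()

  support-inc : ∀ (x y : Fin n) M c e → entry (inc x y M) c e ≢ 0 → (x , y) ≡ (c , e) ⊎ entry M c e ≢ 0
  support-inc x y M c e entry≢0 with ×-≡-dec _≟_ _≟_ (x , y) (c , e)
  ... | yes xy≡ce = inj₁ xy≡ce
  ... | no xy≢ce = inj₂ (λ Mce≡0 → entry≢0 (trans (entry-modify-≢ suc M xy≢ce) Mce≡0))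

  support-dec : ∀ (x y : Fin n) M c e → entry (dec x y M) c e ≢ 0 → entry M c e ≢ 0
  support-dec x y M c e entry≢0 Mce≡0 with ×-≡-dec _≟_ _≟_ (x , y) (c , e)
  ... | yes refl = entry≢0 (trans (entry-modify-≡ pred x y M) (cong pred Mce≡0))
  ... | no xy≢ce = entry≢0 (trans (entry-modify-≢ pred M xy≢ce) Mce≡0)

module Multichains where
  open Matrices
  open import Data.Nat as ℕ using (ℕ; zero; suc; z≤n; s≤s)
  import Data.Nat.Properties as ℕ
  open import Data.Fin as Fin using (Fin; toℕ; zero; suc; _≤_)
  import Data.Fin.Properties as Fin
  open import Data.List using (List; []; _∷_; map; concatMap; allFin)
  open import Data.List.Membership.Propositional using (find; lose)
  open import Data.List.Membership.Propositional.Properties using (∈-map⁺; ∈-map⁻; ∈-allFin; ∈-concatMap⁺; ∈-concatMap⁻)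
  open import Data.List.Relation.Unary.Any using (here)
  import Data.List.Relation.Unary.All as All
  import Data.List.Relation.Unary.All.Properties as All
  import Data.List.Relation.Unary.AllPairs as AllPairs
  import Data.List.Relation.Unary.AllPairs.Properties as AllPairs
  import Data.List.Relation.Unary.Unique.Propositional.Properties as Unique
  open import Data.Product using (_×_; _,_; proj₁; proj₂; ∃; ∃₂)
  open import Data.Sum using (inj₁; inj₂)
  open import Data.Empty using (⊥-elim)
  open import Function.Bundles using (mk⇔)
  open import Relation.Nullary using (yes; no)
  open import Relation.Binary.PropositionalEquality

  private variable
    A B : Set
    n : ℕ

  Unique-concatMap : ∀ (g : A → List B) {xs} → Unique xs → (∀ x → Unique (g x)) →
    (∀ {x x′ z} → z ∈ g x → z ∈ g x′ → x ≡ x′) → Unique (concatMap g xs)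
  Unique-concatMap g {xs} xs! g! disjoint = Unique.concat⁺ (All.map⁺ (All.universal g! xs))
    (AllPairs.map⁺ (AllPairs.map (λ x≢x′ {_} z∈both → x≢x′ (disjoint (proj₁ z∈both) (proj₂ z∈both))) xs!))

  allFin≥ : Fin n → List (Fin n)
  allFin≥ {suc n} zero = allFin (suc n)
  allFin≥ {suc n} (suc a) = map suc (allFin≥ a)

  ∈-allFin≥⁺ : ∀ {a x : Fin n} → a ≤ x → x ∈ allFin≥ a
  ∈-allFin≥⁺ {suc n} {zero} {x} _ = ∈-allFin x
  ∈-allFin≥⁺ {suc n} {suc a} {suc x} (s≤s a≤x) = ∈-map⁺ suc (∈-allFin≥⁺ a≤x)

  ∈-allFin≥⁻ : ∀ {a x : Fin n} → x ∈ allFin≥ a → a ≤ x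
  ∈-allFin≥⁻ {suc n} {zero} _ = z≤n
  ∈-allFin≥⁻ {suc n} {suc a} x∈ with ∈-map⁻ suc x∈
  ... | y , y∈ , refl = s≤s (∈-allFin≥⁻ y∈)

  allFin≥-Unique : ∀ (a : Fin n) → Unique (allFin≥ a)
  allFin≥-Unique {suc n} zero = Unique.allFin⁺ (suc n)
  allFin≥-Unique {suc n} (suc a) = Unique.map⁺ Fin.suc-injective (allFin≥-Unique a)

  multichains : ℕ → Fin n → Fin n → List (Mat n)
  multichains zero a b = zeroMat ∷ []
  multichains (suc d) a b =
    concatMap (λ x → concatMap (λ y → map (inc x y) (multichains d x y)) (allFin≥ b)) (allFin≥ a)

  ∈-multichains⁻ : ∀ d (a b : Fin n) {M} → M ∈ multichains (suc d) a b →
    ∃₂ λ x y → a ≤ x × b ≤ y × ∃ λ M′ → M′ ∈ multichains d x y × M ≡ inc x y M′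
  ∈-multichains⁻ d a b M∈
    with x , x∈ , M∈ₓ ← find (∈-concatMap⁻ _ {xs = allFin≥ a} M∈)
    with y , y∈ , M∈ₓᵧ ← find (∈-concatMap⁻ _ {xs = allFin≥ b} M∈ₓ)
    with M′ , M′∈ , refl ← ∈-map⁻ (inc x y) M∈ₓᵧ
    = x , y , ∈-allFin≥⁻ x∈ , ∈-allFin≥⁻ y∈ , M′ , M′∈ , refl

  ∈-multichains⁺ : ∀ d {a b x y : Fin n} {M′} → a ≤ x → b ≤ y → M′ ∈ multichains d x y →
    inc x y M′ ∈ multichains (suc d) a b
  ∈-multichains⁺ d {a} {b} {x} {y} a≤x b≤y M′∈ =
    ∈-concatMap⁺ _ {xs = allFin≥ a} (lose (∈-allFin≥⁺ a≤x)
      (∈-concatMap⁺ _ {xs = allFin≥ b} (lose (∈-allFin≥⁺ b≤y) (∈-map⁺ (inc x y) M′∈))))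

  SupportAbove : Fin n → Fin n → Mat n → Set
  SupportAbove a b M = ∀ c e → entry M c e ≢ 0 → a ≤ c × b ≤ e

  IsMultichain : ℕ → Fin n → Fin n → Mat n → Set
  IsMultichain d a b M = WidthOne M × total M ≡ d × SupportAbove a b M

  inc-IsMultichain : ∀ d {a b x y : Fin n} M → a ≤ x → b ≤ y →
    IsMultichain d x y M → IsMultichain (suc d) a b (inc x y M)
  inc-IsMultichain d {a} {b} {x} {y} M a≤x b≤y (widthOne , total≡d , above) =
    widthOne′ , trans (total-inc x y M) (cong suc total≡d) , above′
    where
    above′ : SupportAbove a b (inc x y M)
    above′ c e entry≢0 with support-inc x y M c e entry≢0
    ... | inj₁ refl = a≤x , b≤y
    ... | inj₂ Mce≢0 = let x≤c , y≤e = above c e Mce≢0 in ℕ.≤-trans a≤x x≤c , ℕ.≤-trans b≤y y≤e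
    widthOne′ : WidthOne (inc x y M)
    widthOne′ c e c′ e′ ce≢0 ce′≢0 with support-inc x y M c e ce≢0 | support-inc x y M c′ e′ ce′≢0
    ... | inj₁ refl | inj₁ refl = inj₁ (ℕ.≤-refl , ℕ.≤-refl)
    ... | inj₁ refl | inj₂ Mce′≢0 = inj₁ (above c′ e′ Mce′≢0)
    ... | inj₂ Mce≢0 | inj₁ refl = inj₂ (above c e Mce≢0)
    ... | inj₂ Mce≢0 | inj₂ Mce′≢0 = widthOne c e c′ e′ Mce≢0 Mce′≢0

  multichains-sound : ∀ d (a b : Fin n) {M} → M ∈ multichains d a b → IsMultichain d a b M
  multichains-sound {n} zero a b (here refl) =
    (λ c e _ _ ce≢0 _ → ⊥-elim (ce≢0 (entry-zeroMat c e))) , total-zeroMat {n} , λ c e ce≢0 → ⊥-elim (ce≢0 (entry-zeroMat c e))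
  multichains-sound (suc d) a b M∈ with ∈-multichains⁻ d a b M∈
  ... | x , y , a≤x , b≤y , M′ , M′∈ , refl = inc-IsMultichain d M′ a≤x b≤y (multichains-sound d x y M′∈)

  below-smallest : ∀ {P : Fin n → Set} {i} → (∀ (j : Fin.Fin′ i) → P (Fin.inject j)) →
    ∀ c → toℕ c ℕ.< toℕ i → P c
  below-smallest {P = P} below c c<i = subst P (Fin.toℕ-injective (trans (Fin.toℕ-inject j) (Fin.toℕ-fromℕ< c<i))) (below j)
    where j = Fin.fromℕ< c<i

  LeastSupport : Fin n → Fin n → Mat n → Set
  LeastSupport x y M = entry M x y ≢ 0 × SupportAbove x y M

  least-support : ∀ (M : Mat n) → WidthOne M → total M ≢ 0 → ∃₂ λ x y → LeastSupport x y M
  least-support {n} M widthOne total≢0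
    with x , row≢0 , rows-below ← Fin.¬∀⟶∃¬-smallest n (λ c → ∀ e → entry M c e ≡ 0)
           (λ c → Fin.all? (λ e → entry M c e ℕ.≟ 0))
           (λ all-zero → let a , b , ab≢0 = total≢0⇒entry≢0 M total≢0 in ab≢0 (all-zero a b))
    with y , xy≢0 , columns-before ← Fin.¬∀⟶∃¬-smallest n (λ e → entry M x e ≡ 0) (λ e → entry M x e ℕ.≟ 0) row≢0
    = x , y , xy≢0 , above
    where
    above : SupportAbove x y M
    above c e ce≢0 with widthOne x y c e xy≢0 ce≢0
    ... | inj₁ xy≤ce = xy≤ce
    ... | inj₂ (c≤x , e≤y) with toℕ c ℕ.<? toℕ x
    ...   | yes c<x = ⊥-elim (ce≢0 (below-smallest {P = λ c → ∀ e → entry M c e ≡ 0} rows-below c c<x e))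
    ...   | no c≮x with Fin.toℕ-injective (ℕ.≤-antisym c≤x (ℕ.≮⇒≥ c≮x))
    ...     | refl with toℕ e ℕ.<? toℕ y
    ...       | yes e<y = ⊥-elim (ce≢0 (below-smallest columns-before e e<y))
    ...       | no e≮y = ℕ.≤-refl , ℕ.≮⇒≥ e≮y

  LeastSupport-unique : ∀ {x y x′ y′ : Fin n} M → LeastSupport x y M → LeastSupport x′ y′ M → x ≡ x′ × y ≡ y′
  LeastSupport-unique {x = x} {y} {x′} {y′} M (xy≢0 , above) (x′y′≢0 , above′) =
    Fin.≤-antisym (proj₁ (above x′ y′ x′y′≢0)) (proj₁ (above′ x y xy≢0)) ,
    Fin.≤-antisym (proj₂ (above x′ y′ x′y′≢0)) (proj₂ (above′ x y xy≢0))

  dec-IsMultichain : ∀ d {x y : Fin n} M → WidthOne M → total M ≡ suc d → LeastSupport x y M →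
    IsMultichain d x y (dec x y M)
  dec-IsMultichain d {x} {y} M widthOne total≡1+d (xy≢0 , above) =
    (λ c e c′ e′ ce≢0 ce′≢0 → widthOne c e c′ e′ (support-dec x y M c e ce≢0) (support-dec x y M c′ e′ ce′≢0)) ,
    ℕ.suc-injective (trans (sym (total-inc x y (dec x y M))) (trans (cong total (inc∘dec x y M xy≢0)) total≡1+d)) ,
    λ c e ce≢0 → above c e (support-dec x y M c e ce≢0)

  multichains-complete : ∀ d (a b : Fin n) {M} → IsMultichain d a b M → M ∈ multichains d a b
  multichains-complete zero a b {M} (_ , total≡0 , _) = here (total≡0⇒zeroMat M total≡0)
  multichains-complete (suc d) a b {M} (widthOne , total≡1+d , above)
    with x , y , least@(xy≢0 , _) ← least-support M widthOne (λ total≡0 → ℕ.1+n≢0 (trans (sym total≡1+d) total≡0))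
    = subst (_∈ multichains (suc d) a b) (inc∘dec x y M xy≢0)
        (∈-multichains⁺ d (proj₁ (above x y xy≢0)) (proj₂ (above x y xy≢0))
          (multichains-complete d x y (dec-IsMultichain d M widthOne total≡1+d least)))

  ∈-map-inc⁻ : ∀ d {x y : Fin n} {M} → M ∈ map (inc x y) (multichains d x y) → LeastSupport x y M
  ∈-map-inc⁻ d {x} {y} M∈ with M′ , M′∈ , refl ← ∈-map⁻ (inc x y) M∈ =
    entry-inc-≢0 x y M′ , proj₂ (proj₂ (inc-IsMultichain d M′ ℕ.≤-refl ℕ.≤-refl (multichains-sound d x y M′∈)))

  multichains-Unique : ∀ d (a b : Fin n) → Unique (multichains d a b)
  multichains-Unique zero a b = All.[] AllPairs.∷ AllPairs.[]
  multichains-Unique (suc d) a b =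
    Unique-concatMap _ (allFin≥-Unique a) row-Unique
      (λ {z = M} M∈ M∈′ → proj₁ (LeastSupport-unique M (proj₂ (row-least M∈)) (proj₂ (row-least M∈′))))
    where
    row : Fin _ → List (Mat _)
    row x = concatMap (λ y → map (inc x y) (multichains d x y)) (allFin≥ b)
    row-Unique : ∀ x → Unique (row x)
    row-Unique x = Unique-concatMap _ (allFin≥-Unique b)
      (λ y → Unique.map⁺ (inc-injective x y) (multichains-Unique d x y))
      (λ {z = M} M∈ M∈′ → proj₂ (LeastSupport-unique M (∈-map-inc⁻ d M∈) (∈-map-inc⁻ d M∈′)))
    row-least : ∀ {x M} → M ∈ row x → ∃ λ y → LeastSupport x y M
    row-least {x} M∈ with y , _ , M∈ᵧ ← find (∈-concatMap⁻ _ {xs = allFin≥ b} M∈) = y , ∈-map-inc⁻ d M∈ᵧ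

  ∈-multichains⇔InT : ∀ d {n} (M : Mat (suc n)) → (M ∈ multichains d zero zero) ⇔ InT d (suc n) M
  ∈-multichains⇔InT d M = mk⇔
    (λ M∈ → let widthOne , total≡d , _ = multichains-sound d zero zero M∈ in widthOne , total≡d)
    (λ (widthOne , total≡d) → multichains-complete d zero zero (widthOne , total≡d , λ _ _ _ → z≤n , z≤n))

module EntrySums where
  open Sums
  open Binomials
  open Matrices
  open Multichains
  open import Data.Nat
  open import Data.Nat.Properties hiding (_≟_)
  open import Data.Nat.Tactic.RingSolver using (solve-∀)
  open import Data.Fin as Fin using (Fin; toℕ; zero; suc)
  import Data.Fin.Properties as Fin
  open import Data.List using (List; []; _∷_; map; concatMap; applyUpTo; tabulate; length)
  open import Data.List.Properties using (map-∘; map-tabulate; length-map)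
  open import Data.List.Membership.Propositional using (_∉_)
  open import Data.List.Relation.Unary.Any using (here; there)
  import Data.List.Relation.Unary.All as All
  import Data.List.Relation.Unary.AllPairs as AllPairs
  open import Relation.Nullary using (yes; no)
  open import Function using (_∘_)
  open import Relation.Binary.PropositionalEquality

  private variable
    A : Set
    n : ℕ

  sum-map-δ-∉ : ∀ (i : Fin n) (F : Fin n → ℕ) xs → i ∉ xs → sum (map (λ x → δ x i * F x) xs) ≡ 0
  sum-map-δ-∉ i F [] _ = refl
  sum-map-δ-∉ i F (x ∷ xs) i∉ = cong₂ _+_ (cong (_* F x) (δ-≢ (λ x≡i → i∉ (here (sym x≡i)))))
    (sum-map-δ-∉ i F xs (λ i∈ → i∉ (there i∈)))

  sum-map-δ-∈ : ∀ (i : Fin n) (F : Fin n → ℕ) xs → Unique xs → i ∈ xs → sum (map (λ x → δ x i * F x) xs) ≡ F i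
  sum-map-δ-∈ i F (i ∷ xs) (i∉ AllPairs.∷ _) (here refl) = trans
    (cong₂ _+_ (trans (cong (_* F i) (δ-refl i)) (+-identityʳ (F i))) (sum-map-δ-∉ i F xs (λ i∈ → All.lookup i∉ i∈ refl)))
    (+-identityʳ (F i))
  sum-map-δ-∈ i F (x ∷ xs) (x∉ AllPairs.∷ xs!) (there i∈) =
    cong₂ _+_ (cong (_* F x) (δ-≢ (All.lookup x∉ i∈))) (sum-map-δ-∈ i F xs xs! i∈)

  tabulate-toℕ : ∀ n (F : ℕ → ℕ) → tabulate {n = n} (F ∘ toℕ) ≡ applyUpTo F n
  tabulate-toℕ zero F = refl
  tabulate-toℕ (suc n) F = cong (F 0 ∷_) (tabulate-toℕ n (F ∘ suc))

  sum-allFin≥ : ∀ (a : Fin n) (F : ℕ → ℕ) →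
    sum (map (F ∘ toℕ) (allFin≥ a)) ≡ sum (applyUpTo (λ k → F (toℕ a + k)) (n ∸ toℕ a))
  sum-allFin≥ {suc n} zero F = cong sum (trans (map-tabulate (λ x → x) (F ∘ toℕ)) (tabulate-toℕ (suc n) F))
  sum-allFin≥ {suc n} (suc a) F = trans (cong sum (sym (map-∘ (allFin≥ a)))) (sum-allFin≥ a (F ∘ suc))

  sum-allFin≥-between : ∀ (a : Fin n) {i} t → i < n →
    sum (map (λ x → between (toℕ x) i t) (allFin≥ a)) ≡ between (toℕ a) i (suc t)
  sum-allFin≥-between {n} a {i} t i<n = trans (sum-allFin≥ a (λ x → between x i t))
    (hockey-stick (toℕ a) (n ∸ toℕ a) t (subst (i <_) (sym (m+[n∸m]≡n (<⇒≤ (Fin.toℕ<n a)))) i<n))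

  sum-allFin≥-δ : ∀ (a i : Fin n) (F : Fin n → ℕ) →
    sum (map (λ x → δ x i * F x) (allFin≥ a)) ≡ between (toℕ a) (toℕ i) 0 * F i
  sum-allFin≥-δ a i F with toℕ a ≤? toℕ i
  ... | yes a≤i = begin
    sum (map (λ x → δ x i * F x) (allFin≥ a))  ≡⟨ sum-map-δ-∈ i F (allFin≥ a) (allFin≥-Unique a) (∈-allFin≥⁺ a≤i) ⟩
    F i                                        ≡⟨ +-identityʳ (F i) ⟨
    1 * F i                                    ≡⟨ cong (_* F i) (trans (between-≤ 0 a≤i) (paths-zeroʳ (toℕ i ∸ toℕ a))) ⟨
    between (toℕ a) (toℕ i) 0 * F i            ∎
    where open ≡-Reasoning
  ... | no a≰i = trans (sum-map-δ-∉ i F (allFin≥ a) (λ i∈ → a≰i (∈-allFin≥⁻ i∈)))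
    (sym (cong (_* F i) (between-> 0 (≰⇒> a≰i))))

  pred[n]<n : Fin n → pred n < n
  pred[n]<n {suc n} _ = n<1+n n

  -- count d a = C(n-1-a+d, d) counts the nondecreasing sequences of length d in [a, n);
  -- countAt i d t a counts those whose t-th term is i: t terms in [a, i] precede it and
  -- d-1-t terms in [i, n) follow it.
  count : ℕ → Fin n → ℕ
  count {n} d a = between (toℕ a) (pred n) d

  countAt : Fin n → ℕ → ℕ → Fin n → ℕ
  countAt i d t a = between (toℕ a) (toℕ i) t * count (d ∸ suc t) i

  sum-count : ∀ d (a : Fin n) → sum (map (count d) (allFin≥ a)) ≡ count (suc d) a
  sum-count d a = sum-allFin≥-between a d (pred[n]<n a)

  sum-countAt : ∀ (i : Fin n) d t (a : Fin n) → sum (map (countAt i d t) (allFin≥ a)) ≡ countAt i (suc d) (suc t) a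
  sum-countAt i d t a = trans (sum-map-*ʳ (count (d ∸ suc t) i) (λ x → between (toℕ x) (toℕ i) t) (allFin≥ a))
    (cong (_* count (d ∸ suc t) i) (sum-allFin≥-between a t (Fin.toℕ<n i)))

  sum-δ-count : ∀ (i : Fin n) d (a : Fin n) → sum (map (λ x → δ x i * count d x) (allFin≥ a)) ≡ countAt i (suc d) 0 a
  sum-δ-count i d a = sum-allFin≥-δ a i (count d)

  count-zero : ∀ (a : Fin n) → count 0 a ≡ 1
  count-zero {n} a = trans (between-≤ 0 (Fin.toℕ≤pred[n] a)) (paths-zeroʳ (pred n ∸ toℕ a))

  length-multichains : ∀ d (a b : Fin n) → length (multichains d a b) ≡ count d a * count d b
  length-multichains zero a b = sym (cong₂ _*_ (count-zero a) (count-zero b))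
  length-multichains (suc d) a b = begin
    length (multichains (suc d) a b)
      ≡⟨ length-concatMap _ (allFin≥ a) ⟩
    sum (map (λ x → length (concatMap (λ y → map (inc x y) (multichains d x y)) (allFin≥ b))) (allFin≥ a))
      ≡⟨ sum-map-cong (allFin≥ a) (λ x → trans (length-concatMap _ (allFin≥ b))
           (sum-map-cong (allFin≥ b) (λ y → trans (length-map (inc x y) (multichains d x y)) (length-multichains d x y)))) ⟩
    sum (map (λ x → sum (map (λ y → count d x * count d y) (allFin≥ b))) (allFin≥ a))
      ≡⟨ sum-map-product (count d) (count d) (allFin≥ a) (allFin≥ b) ⟩
    sum (map (count d) (allFin≥ a)) * sum (map (count d) (allFin≥ b))
      ≡⟨ cong₂ _*_ (sum-count d a) (sum-count d b) ⟩
    count (suc d) a * count (suc d) b ∎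
    where open ≡-Reasoning

  sum-map-multichains-suc : ∀ (f : Mat n → ℕ) d (a b : Fin n) →
    sum (map f (multichains (suc d) a b)) ≡
    sum (map (λ x → sum (map (λ y → sum (map (f ∘ inc x y) (multichains d x y))) (allFin≥ b))) (allFin≥ a))
  sum-map-multichains-suc f d a b = trans (sum-concatMap f _ (allFin≥ a)) (sum-map-cong (allFin≥ a) λ x →
    trans (sum-concatMap f _ (allFin≥ b)) (sum-map-cong (allFin≥ b) λ y → cong sum (sym (map-∘ (multichains d x y)))))

  sum-entry-inc : ∀ (i j x y : Fin n) d →
    sum (map (λ T → entry (inc x y T) i j) (multichains d x y)) ≡
    sum (map (λ T → entry T i j) (multichains d x y)) + δ x i * count d x * (δ y j * count d y)
  sum-entry-inc i j x y d = begin
    sum (map (λ T → entry (inc x y T) i j) Ms)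
      ≡⟨ sum-map-cong Ms (λ T → entry-inc x y T i j) ⟩
    sum (map (λ T → entry T i j + δ x i * δ y j) Ms)
      ≡⟨ sum-map-+ (λ T → entry T i j) (λ _ → δ x i * δ y j) Ms ⟩
    sum (map (λ T → entry T i j) Ms) + sum (map (λ _ → δ x i * δ y j) Ms)
      ≡⟨ cong (sum (map (λ T → entry T i j) Ms) +_) (sum-map-const (δ x i * δ y j) Ms) ⟩
    sum (map (λ T → entry T i j) Ms) + δ x i * δ y j * length Ms
      ≡⟨ cong (λ m → sum (map (λ T → entry T i j) Ms) + δ x i * δ y j * m) (length-multichains d x y) ⟩
    sum (map (λ T → entry T i j) Ms) + δ x i * δ y j * (count d x * count d y)
      ≡⟨ cong (sum (map (λ T → entry T i j) Ms) +_) (interchange (δ x i) (δ y j) (count d x) (count d y)) ⟩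
    sum (map (λ T → entry T i j) Ms) + δ x i * count d x * (δ y j * count d y) ∎
    where
    open ≡-Reasoning
    Ms : List (Mat _)
    Ms = multichains d x y
    interchange : ∀ p q u v → p * q * (u * v) ≡ p * u * (q * v)
    interchange = solve-∀

  sum-sum-countAt-products : ∀ (i j : Fin n) d (a b : Fin n) →
    sum (map (λ x → sum (map (λ y → sum (applyUpTo (λ t → countAt i d t x * countAt j d t y) d)) (allFin≥ b))) (allFin≥ a)) ≡
    sum (applyUpTo (λ t → countAt i (suc d) (suc t) a * countAt j (suc d) (suc t) b) d)
  sum-sum-countAt-products i j d a b = begin
    sum (map (λ x → sum (map (λ y → sum (applyUpTo (λ t → f t x * g t y) d)) (allFin≥ b))) (allFin≥ a))
      ≡⟨ sum-map-cong (allFin≥ a) (λ x → sum-map-sum-applyUpTo (λ t y → f t x * g t y) d (allFin≥ b)) ⟩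
    sum (map (λ x → sum (applyUpTo (λ t → sum (map (λ y → f t x * g t y) (allFin≥ b))) d)) (allFin≥ a))
      ≡⟨ sum-map-sum-applyUpTo (λ t x → sum (map (λ y → f t x * g t y) (allFin≥ b))) d (allFin≥ a) ⟩
    sum (applyUpTo (λ t → sum (map (λ x → sum (map (λ y → f t x * g t y) (allFin≥ b))) (allFin≥ a))) d)
      ≡⟨ cong sum (applyUpTo-cong d (λ t _ → trans (sum-map-product (f t) (g t) (allFin≥ a) (allFin≥ b))
           (cong₂ _*_ (sum-countAt i d t a) (sum-countAt j d t b)))) ⟩
    sum (applyUpTo (λ t → countAt i (suc d) (suc t) a * countAt j (suc d) (suc t) b) d) ∎
    where
    open ≡-Reasoning
    f g : ℕ → Fin _ → ℕ
    f t = countAt i d t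
    g t = countAt j d t

  sum-entry-multichains : ∀ (i j : Fin n) d (a b : Fin n) →
    sum (map (λ T → entry T i j) (multichains d a b)) ≡ sum (applyUpTo (λ t → countAt i d t a * countAt j d t b) d)
  sum-entry-multichains i j zero a b = trans (+-identityʳ (entry zeroMat i j)) (entry-zeroMat i j)
  sum-entry-multichains i j (suc d) a b = begin
    sum (map (λ T → entry T i j) (multichains (suc d) a b))
      ≡⟨ sum-map-multichains-suc (λ T → entry T i j) d a b ⟩
    sum (map (λ x → sum (map (λ y → sum (map (λ T → entry (inc x y T) i j) (multichains d x y))) (allFin≥ b))) (allFin≥ a))
      ≡⟨ sum-map-cong (allFin≥ a) (λ x → sum-map-cong (allFin≥ b) λ y →
           trans (sum-entry-inc i j x y d) (cong (_+ new x y) (sum-entry-multichains i j d x y))) ⟩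
    sum (map (λ x → sum (map (λ y → earlier x y + new x y) (allFin≥ b))) (allFin≥ a))
      ≡⟨ sum-map-cong (allFin≥ a) (λ x → sum-map-+ (earlier x) (new x) (allFin≥ b)) ⟩
    sum (map (λ x → sum (map (earlier x) (allFin≥ b)) + sum (map (new x) (allFin≥ b))) (allFin≥ a))
      ≡⟨ sum-map-+ _ _ (allFin≥ a) ⟩
    sum (map (λ x → sum (map (earlier x) (allFin≥ b))) (allFin≥ a)) + sum (map (λ x → sum (map (new x) (allFin≥ b))) (allFin≥ a))
      ≡⟨ cong₂ _+_ (sum-sum-countAt-products i j d a b)
           (trans (sum-map-product (λ x → δ x i * count d x) (λ y → δ y j * count d y) (allFin≥ a) (allFin≥ b))
                  (cong₂ _*_ (sum-δ-count i d a) (sum-δ-count j d b))) ⟩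
    sum (applyUpTo (λ t → countAt i (suc d) (suc t) a * countAt j (suc d) (suc t) b) d) + countAt i (suc d) 0 a * countAt j (suc d) 0 b
      ≡⟨ +-comm _ (countAt i (suc d) 0 a * countAt j (suc d) 0 b) ⟩
    sum (applyUpTo (λ t → countAt i (suc d) t a * countAt j (suc d) t b) (suc d)) ∎
    where
    open ≡-Reasoning
    earlier new : Fin _ → Fin _ → ℕ
    earlier x y = sum (applyUpTo (λ t → countAt i d t x * countAt j d t y) d)
    new x y = δ x i * count d x * (δ y j * count d y)

  sum-entry-multichains-zero : ∀ (i j : Fin (suc n)) d →
    sum (map (λ T → entry T i j) (multichains d zero zero)) ≡
    sum (applyUpTo (λ t → paths (toℕ i) t * paths (n ∸ toℕ i) (d ∸ suc t) *
                          (paths (toℕ j) t * paths (n ∸ toℕ j) (d ∸ suc t))) d)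
  sum-entry-multichains-zero i j d = trans (sum-entry-multichains i j d zero zero)
    (cong sum (applyUpTo-cong d (λ t _ → cong₂ _*_ (countAt-zero i t) (countAt-zero j t))))
    where
    countAt-zero : ∀ (i : Fin (suc n)) t → countAt i d t zero ≡ paths (toℕ i) t * paths (n ∸ toℕ i) (d ∸ suc t)
    countAt-zero i t = cong (paths (toℕ i) t *_) (between-≤ (d ∸ suc t) (Fin.toℕ≤pred[n] i))

module Rationals where
  open import Data.Integer as ℤ using (ℤ; +_; 0ℤ)
  import Data.Integer.Properties as ℤ
  open import Data.Rational as ℚ using (ℚ; mkℚ; 0ℚ; 1ℚ)
  import Data.Rational.Properties as ℚ
  open import Data.Nat.Coprimality using (1-coprimeTo) renaming (sym to coprime-sym)
  open import Data.List using ([]; _∷_; map; foldr)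
  open import Data.Empty using (⊥-elim)
  open import Relation.Nullary using (yes; no)
  open import Relation.Binary.PropositionalEquality

  -- z / 1 is already in lowest terms; rewriting ℤ→ℚ z to that normal form lets the
  -- arithmetic of ℚ compute on it.
  ℤ→ℚ≡mkℚ : ∀ z → ℤ→ℚ z ≡ mkℚ z 0 (coprime-sym (1-coprimeTo ℤ.∣ z ∣))
  ℤ→ℚ≡mkℚ z = ℚ.↥p/↧p≡p (mkℚ z 0 (coprime-sym (1-coprimeTo ℤ.∣ z ∣)))

  ℤ→ℚ-+ : ∀ a b → ℤ→ℚ a ℚ.+ ℤ→ℚ b ≡ ℤ→ℚ (a ℤ.+ b)
  ℤ→ℚ-+ a b rewrite ℤ→ℚ≡mkℚ a | ℤ→ℚ≡mkℚ b =
    cong₂ (λ x y → (x ℤ.+ y) ℚ./ 1) (ℤ.*-identityʳ a) (ℤ.*-identityʳ b)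

  ℤ→ℚ-* : ∀ a b → ℤ→ℚ a ℚ.* ℤ→ℚ b ≡ ℤ→ℚ (a ℤ.* b)
  ℤ→ℚ-* a b rewrite ℤ→ℚ≡mkℚ a | ℤ→ℚ≡mkℚ b = refl

  ℤ→ℚ-injective : ∀ {a b} → ℤ→ℚ a ≡ ℤ→ℚ b → a ≡ b
  ℤ→ℚ-injective {a} {b} eq = cong ℚ.↥_ (trans (sym (ℤ→ℚ≡mkℚ a)) (trans eq (ℤ→ℚ≡mkℚ b)))

  *-÷'-cancel : ∀ p x q y → y ≢ 0ℚ → p ℚ.* x ≡ q ℚ.* y → p ℚ.* (x ÷' y) ≡ q
  *-÷'-cancel p x q y y≢0 eq with y ℚ.≟ 0ℚ
  ... | yes y≡0 = ⊥-elim (y≢0 y≡0)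
  ... | no y≢0′ = begin
    p ℚ.* (x ℚ.* ℚ.1/ y)   ≡⟨ ℚ.*-assoc p x _ ⟨
    p ℚ.* x ℚ.* ℚ.1/ y     ≡⟨ cong (ℚ._* ℚ.1/ y) eq ⟩
    q ℚ.* y ℚ.* ℚ.1/ y     ≡⟨ ℚ.*-assoc q y _ ⟩
    q ℚ.* (y ℚ.* ℚ.1/ y)   ≡⟨ cong (q ℚ.*_) (ℚ.*-inverseʳ y) ⟩
    q ℚ.* 1ℚ               ≡⟨ ℚ.*-identityʳ q ⟩
    q                      ∎
    where
    open ≡-Reasoning
    instance _ = ℚ.≢-nonZero y≢0′

  ℤ→ℚ-÷' : ∀ p x q y → y ≢ 0ℤ → p ℤ.* x ≡ q ℤ.* y → ℤ→ℚ p ℚ.* (ℤ→ℚ x ÷' ℤ→ℚ y) ≡ ℤ→ℚ q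
  ℤ→ℚ-÷' p x q y y≢0 eq =
    *-÷'-cancel (ℤ→ℚ p) (ℤ→ℚ x) (ℤ→ℚ q) (ℤ→ℚ y) (λ y≡0 → y≢0 (ℤ→ℚ-injective y≡0))
    (trans (ℤ→ℚ-* p x) (trans (cong ℤ→ℚ eq) (sym (ℤ→ℚ-* q y))))

  ℕ→ℚ-sum : ∀ xs → ℕ→ℚ (sum xs) ≡ foldr ℚ._+_ 0ℚ (map ℕ→ℚ xs)
  ℕ→ℚ-sum [] = refl
  ℕ→ℚ-sum (x ∷ xs) = trans (sym (ℤ→ℚ-+ (+ x) (+ sum xs))) (cong (ℕ→ℚ x ℚ.+_) (ℕ→ℚ-sum xs))

  *-distribˡ-foldr : ∀ c xs → c ℚ.* foldr ℚ._+_ 0ℚ xs ≡ foldr ℚ._+_ 0ℚ (map (c ℚ.*_) xs)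
  *-distribˡ-foldr c [] = ℚ.*-zeroʳ c
  *-distribˡ-foldr c (x ∷ xs) = trans (ℚ.*-distribˡ-+ c x _) (cong (c ℚ.* x ℚ.+_) (*-distribˡ-foldr c xs))

module Pochhammer where
  open Binomials
  open Rationals
  open import Data.Nat as ℕ using (ℕ; zero; suc; _!)
  import Data.Nat.Properties as ℕ
  open import Data.Integer as ℤ using (ℤ; +_; -_; _+_; _*_; _^_; 0ℤ; 1ℤ; -1ℤ)
  import Data.Integer.Properties as ℤ
  open import Data.Integer.Tactic.RingSolver using (solve-∀)
  open import Data.Rational as ℚ using (ℚ)
  open import Data.Sum using (inj₁; inj₂)
  open import Function using (case_of_)
  open import Relation.Binary.PropositionalEquality

  risingℤ : ℤ → ℕ → ℤ
  risingℤ a zero = 1ℤ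
  risingℤ a (suc k) = risingℤ a k * (a + + k)

  poch-ℤ→ℚ : ∀ a k → poch (ℤ→ℚ a) k ≡ ℤ→ℚ (risingℤ a k)
  poch-ℤ→ℚ a zero = refl
  poch-ℤ→ℚ a (suc k) = trans (cong₂ ℚ._*_ (poch-ℤ→ℚ a k) (ℤ→ℚ-+ a (+ k))) (ℤ→ℚ-* (risingℤ a k) (a + + k))

  risingℤ-suc : ∀ a k → risingℤ a (suc k) ≡ a * risingℤ (a + 1ℤ) k
  risingℤ-suc a zero = unit a
    where
    unit : ∀ a → 1ℤ * (a + + 0) ≡ a * 1ℤ
    unit = solve-∀
  risingℤ-suc a (suc k) = trans (cong (_* (a + + suc k)) (risingℤ-suc a k)) (regroup a (risingℤ (a + 1ℤ) k) (+ k))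
    where
    regroup : ∀ a r k → a * r * (a + (1ℤ + k)) ≡ a * (r * (a + 1ℤ + k))
    regroup = solve-∀

  risingℤ-pos : ∀ m k → risingℤ (+ suc m) k ≡ + (paths m k ℕ.* k !)
  risingℤ-pos m k = trans (risingℤ≡rising (suc m) k) (cong +_ (rising≡paths*factorial m k))
    where
    risingℤ≡rising : ∀ x k → risingℤ (+ x) k ≡ + rising x k
    risingℤ≡rising x zero = refl
    risingℤ≡rising x (suc k) = trans (cong (_* (+ x + + k)) (risingℤ≡rising x k)) (sym (ℤ.pos-* (rising x k) (x ℕ.+ k)))

  risingℤ-neg : ∀ x k → risingℤ (- + x) k ≡ -1ℤ ^ k * + falling x k
  risingℤ-neg x zero = refl
  risingℤ-neg zero (suc k) = trans (risingℤ-suc (- + 0) k) (trans (ℤ.*-zeroˡ (risingℤ 1ℤ k)) (sym (ℤ.*-zeroʳ (-1ℤ ^ suc k))))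
  risingℤ-neg (suc x) (suc k) = begin
    risingℤ (- + suc x) (suc k)                  ≡⟨ risingℤ-suc (- + suc x) k ⟩
    - + suc x * risingℤ (- + suc x + 1ℤ) k       ≡⟨ cong (λ a → - + suc x * risingℤ a k) (shift (+ x)) ⟩
    - + suc x * risingℤ (- + x) k                ≡⟨ cong (- + suc x *_) (risingℤ-neg x k) ⟩
    - + suc x * (-1ℤ ^ k * + falling x k)        ≡⟨ regroup (+ suc x) (-1ℤ ^ k) (+ falling x k) ⟩
    -1ℤ * -1ℤ ^ k * (+ suc x * + falling x k)    ≡⟨ cong (-1ℤ * -1ℤ ^ k *_) (ℤ.pos-* (suc x) (falling x k)) ⟨
    -1ℤ ^ suc k * + falling (suc x) (suc k)      ∎
    where
    open ≡-Reasoning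
    shift : ∀ x → - (1ℤ + x) + 1ℤ ≡ - x
    shift = solve-∀
    regroup : ∀ a s f → - a * (s * f) ≡ -1ℤ * s * (a * f)
    regroup = solve-∀

  risingℤ-1 : ∀ k → risingℤ 1ℤ k ≡ + (k !)
  risingℤ-1 k = trans (risingℤ-pos 0 k) (cong +_ (ℕ.+-identityʳ (k !)))

  risingℤ-neg≢0 : ∀ {x k} → k ℕ.≤ x → risingℤ (- + x) k ≢ 0ℤ
  risingℤ-neg≢0 {x} {k} k≤x eq with ℤ.i*j≡0⇒i≡0∨j≡0 (-1ℤ ^ k) (trans (sym (risingℤ-neg x k)) eq)
  ... | inj₁ sign≡0 = case ℤ.i^n≡0⇒i≡0 -1ℤ k sign≡0 of λ ()
  ... | inj₂ falling≡0 = falling≢0 k≤x (ℤ.+-injective falling≡0)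

  paths*risingℤ-neg : ∀ i t k → + paths i (t ℕ.+ k) * risingℤ (- + (t ℕ.+ k)) k ≡ + paths i t * risingℤ (- + (t ℕ.+ k ℕ.+ i)) k
  paths*risingℤ-neg i t k = begin
    + paths i D * risingℤ (- + D) k
      ≡⟨ cong (+ paths i D *_) (risingℤ-neg D k) ⟩
    + paths i D * (-1ℤ ^ k * + falling D k)
      ≡⟨ swap (+ paths i D) (-1ℤ ^ k) (+ falling D k) ⟩
    -1ℤ ^ k * (+ paths i D * + falling D k)
      ≡⟨ cong (-1ℤ ^ k *_) (ℤ.pos-* (paths i D) (falling D k)) ⟨
    -1ℤ ^ k * + (paths i D ℕ.* falling D k)
      ≡⟨ cong (λ m → -1ℤ ^ k * + m) (paths*falling i t k) ⟩
    -1ℤ ^ k * + (paths i t ℕ.* falling (D ℕ.+ i) k)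
      ≡⟨ cong (-1ℤ ^ k *_) (ℤ.pos-* (paths i t) (falling (D ℕ.+ i) k)) ⟩
    -1ℤ ^ k * (+ paths i t * + falling (D ℕ.+ i) k)
      ≡⟨ swap (-1ℤ ^ k) (+ paths i t) (+ falling (D ℕ.+ i) k) ⟩
    + paths i t * (-1ℤ ^ k * + falling (D ℕ.+ i) k)
      ≡⟨ cong (+ paths i t *_) (risingℤ-neg (D ℕ.+ i) k) ⟨
    + paths i t * risingℤ (- + (D ℕ.+ i)) k
      ∎
    where
    open ≡-Reasoning
    D : ℕ
    D = t ℕ.+ k
    swap : ∀ a b c → a * (b * c) ≡ b * (a * c)
    swap = solve-∀

module HypergeometricTerm where
  open Sums using (applyUpTo-cong; sum-applyUpTo-reverse)
  open Binomials
  open Rationals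
  open Pochhammer
  open import Data.Nat as ℕ using (ℕ; zero; suc; _!; _∸_; _<_)
  import Data.Nat.Properties as ℕ
  open import Data.Nat.Combinatorics using (_C_)
  open import Data.Integer as ℤ using (ℤ; +_; -_; _+_; _-_; _*_; 0ℤ; 1ℤ)
  import Data.Integer.Properties as ℤ
  open import Data.Integer.Tactic.RingSolver using (solve-∀)
  open import Data.Rational as ℚ using (ℚ; 0ℚ; 1ℚ)
  import Data.Rational.Properties as ℚ
  open import Data.List using (foldr; map; applyUpTo)
  open import Data.List.Properties using (map-applyUpTo)
  open import Data.Sum using ([_,_]′)
  open import Relation.Binary.PropositionalEquality

  rhsPrefactor : (d i j : ℕ) → ℚ
  rhsPrefactor d i j = ℕ→ℚ (((i ℕ.+ d) ∸ 2) C (d ∸ 1)) ℚ.* ℕ→ℚ (((j ℕ.+ d) ∸ 2) C (d ∸ 1))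

  rhsTerm : (d n i j : ℕ) → ℕ → ℚ
  rhsTerm d n i j = term43 (ℤ→ℚ (+ n - + i + + 1)) (ℤ→ℚ (+ n - + j + + 1)) (ℤ→ℚ (+ 1 - + d)) (ℤ→ℚ (+ 1 - + d))
    1ℚ (ℤ→ℚ (+ 2 - + d - + i)) (ℤ→ℚ (+ 2 - + d - + j)) 1ℚ

  powers-of-1 : (f : ℕ → ℚ) → f 0 ≡ 1ℚ → (∀ m → f (suc m) ≡ f m ℚ.* 1ℚ) → ∀ m → f m ≡ 1ℚ
  powers-of-1 f f0≡1 f-suc zero = f0≡1
  powers-of-1 f f0≡1 f-suc (suc m) = trans (f-suc m) (cong (ℚ._* 1ℚ) (powers-of-1 f f0≡1 f-suc m))

  term43-at-1 : ∀ a₁ a₂ a₃ a₄ b₁ b₂ b₃ k → term43 a₁ a₂ a₃ a₄ b₁ b₂ b₃ 1ℚ k ≡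
    (poch a₁ k ℚ.* poch a₂ k ℚ.* poch a₃ k ℚ.* poch a₄ k) ÷' (poch b₁ k ℚ.* poch b₂ k ℚ.* poch b₃ k ℚ.* poch 1ℚ k)
  -- The power z^k is local to term43, so it is reached by unification; the let puts
  -- the metavariable for it outside the scope of k.
  term43-at-1 a₁ a₂ a₃ a₄ b₁ b₂ b₃ =
    let z^k≡1 = powers-of-1 _ refl (λ _ → refl) in λ k →
    trans (cong (λ z^k → (numerator k ℚ.* z^k) ÷' denominator k) (z^k≡1 k))
          (cong (_÷' denominator k) (ℚ.*-identityʳ (numerator k)))
    where
    numerator denominator : ℕ → ℚ
    numerator k = poch a₁ k ℚ.* poch a₂ k ℚ.* poch a₃ k ℚ.* poch a₄ k
    denominator k = poch b₁ k ℚ.* poch b₂ k ℚ.* poch b₃ k ℚ.* poch 1ℚ k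

  term43-ℤ : ∀ a₁ a₂ a₃ a₄ b₂ b₃ k →
    term43 (ℤ→ℚ a₁) (ℤ→ℚ a₂) (ℤ→ℚ a₃) (ℤ→ℚ a₄) 1ℚ (ℤ→ℚ b₂) (ℤ→ℚ b₃) 1ℚ k ≡
    ℤ→ℚ (risingℤ a₁ k * risingℤ a₂ k * risingℤ a₃ k * risingℤ a₄ k) ÷'
    ℤ→ℚ (risingℤ 1ℤ k * risingℤ b₂ k * risingℤ b₃ k * risingℤ 1ℤ k)
  term43-ℤ a₁ a₂ a₃ a₄ b₂ b₃ k =
    trans (term43-at-1 _ _ _ _ _ _ _ k) (cong₂ _÷'_ (product a₁ a₂ a₃ a₄) (product 1ℤ b₂ b₃ 1ℤ))
    where
    product : ∀ a b c d → poch (ℤ→ℚ a) k ℚ.* poch (ℤ→ℚ b) k ℚ.* poch (ℤ→ℚ c) k ℚ.* poch (ℤ→ℚ d) k ≡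
      ℤ→ℚ (risingℤ a k * risingℤ b k * risingℤ c k * risingℤ d k)
    product a b c d rewrite poch-ℤ→ℚ a k | poch-ℤ→ℚ b k | poch-ℤ→ℚ c k | poch-ℤ→ℚ d k
      | ℤ→ℚ-* (risingℤ a k) (risingℤ b k) | ℤ→ℚ-* (risingℤ a k * risingℤ b k) (risingℤ c k) =
      ℤ→ℚ-* (risingℤ a k * risingℤ b k * risingℤ c k) (risingℤ d k)

  upper-parameter : ∀ {n i} → i < n → + n - + suc i + + 1 ≡ + suc (n ∸ suc i)
  upper-parameter {n} {i} i<n = begin
    + n - + suc i + + 1                        ≡⟨ cong (λ m → + m - + suc i + + 1) (ℕ.m+[n∸m]≡n i<n) ⟨
    + (suc i ℕ.+ (n ∸ suc i)) - + suc i + + 1  ≡⟨ cong (λ z → z - + suc i + + 1) (ℤ.pos-+ (suc i) (n ∸ suc i)) ⟩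
    + suc i + + (n ∸ suc i) - + suc i + + 1    ≡⟨ cancel (+ suc i) (+ (n ∸ suc i)) ⟩
    + suc (n ∸ suc i)                          ∎
    where
    open ≡-Reasoning
    cancel : ∀ x y → x + y - x + + 1 ≡ + 1 + y
    cancel = solve-∀

  lower-parameter : ∀ D → + 1 - + suc D ≡ - + D
  lower-parameter D = cancel (+ D)
    where
    cancel : ∀ x → + 1 - (+ 1 + x) ≡ - x
    cancel = solve-∀

  lower-parameter′ : ∀ D i → + 2 - + suc D - + suc i ≡ - + (D ℕ.+ i)
  lower-parameter′ D i = trans (cancel (+ D) (+ i)) (cong -_ (sym (ℤ.pos-+ D i)))
    where
    cancel : ∀ x y → + 2 - (+ 1 + x) - (+ 1 + y) ≡ - (x + y)
    cancel = solve-∀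

  prefactor≡paths : ∀ i D → ((suc i ℕ.+ suc D) ∸ 2) C D ≡ paths i D
  prefactor≡paths i D = trans (cong (λ m → (m ∸ 1) C D) (ℕ.+-suc i D)) (sym (paths≡C i D))

  rhsTerm-ℤ : ∀ n i j D k → i < n → j < n →
    rhsTerm (suc D) n (suc i) (suc j) k ≡
    ℤ→ℚ (+ paths (n ∸ suc i) k * + (k !) * (+ paths (n ∸ suc j) k * + (k !)) * risingℤ (- + D) k * risingℤ (- + D) k) ÷'
    ℤ→ℚ (+ (k !) * risingℤ (- + (D ℕ.+ i)) k * risingℤ (- + (D ℕ.+ j)) k * + (k !))
  rhsTerm-ℤ n i j D k i<n j<n = trans (term43-ℤ _ _ _ _ _ _ k) (cong₂ (λ x y → ℤ→ℚ x ÷' ℤ→ℚ y)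
    (cong₂ _*_ (cong₂ _*_ (cong₂ _*_ (upper i<n) (upper j<n)) lower) lower)
    (cong₂ _*_ (cong₂ _*_ (cong₂ _*_ (risingℤ-1 k) (lower′ i)) (lower′ j)) (risingℤ-1 k)))
    where
    upper : ∀ {m} → m < n → risingℤ (+ n - + suc m + + 1) k ≡ + paths (n ∸ suc m) k * + (k !)
    upper {m} m<n = trans (cong (λ a → risingℤ a k) (upper-parameter m<n))
      (trans (risingℤ-pos (n ∸ suc m) k) (ℤ.pos-* (paths (n ∸ suc m) k) (k !)))
    lower : risingℤ (+ 1 - + suc D) k ≡ risingℤ (- + D) k
    lower = cong (λ a → risingℤ a k) (lower-parameter D)
    lower′ : ∀ m → risingℤ (+ 2 - + suc D - + suc m) k ≡ risingℤ (- + (D ℕ.+ m)) k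
    lower′ m = cong (λ a → risingℤ a k) (lower-parameter′ D m)

  exchange : ∀ cᵢ cⱼ pᵢ pⱼ aᵢ aⱼ f r rᵢ rⱼ → cᵢ * r ≡ pᵢ * rᵢ → cⱼ * r ≡ pⱼ * rⱼ →
    cᵢ * cⱼ * (aᵢ * f * (aⱼ * f) * r * r) ≡ pᵢ * aᵢ * (pⱼ * aⱼ) * (f * rᵢ * rⱼ * f)
  exchange cᵢ cⱼ pᵢ pⱼ aᵢ aⱼ f r rᵢ rⱼ eqᵢ eqⱼ = begin
    cᵢ * cⱼ * (aᵢ * f * (aⱼ * f) * r * r)     ≡⟨ regroupˡ cᵢ cⱼ aᵢ aⱼ f r ⟩
    cᵢ * r * (cⱼ * r) * (aᵢ * aⱼ * f * f)     ≡⟨ cong₂ (λ x y → x * y * (aᵢ * aⱼ * f * f)) eqᵢ eqⱼ ⟩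
    pᵢ * rᵢ * (pⱼ * rⱼ) * (aᵢ * aⱼ * f * f)   ≡⟨ regroupʳ pᵢ pⱼ aᵢ aⱼ f rᵢ rⱼ ⟩
    pᵢ * aᵢ * (pⱼ * aⱼ) * (f * rᵢ * rⱼ * f)   ∎
    where
    open ≡-Reasoning
    regroupˡ : ∀ cᵢ cⱼ aᵢ aⱼ f r →
      cᵢ * cⱼ * (aᵢ * f * (aⱼ * f) * r * r) ≡ cᵢ * r * (cⱼ * r) * (aᵢ * aⱼ * f * f)
    regroupˡ = solve-∀
    regroupʳ : ∀ pᵢ pⱼ aᵢ aⱼ f rᵢ rⱼ →
      pᵢ * rᵢ * (pⱼ * rⱼ) * (aᵢ * aⱼ * f * f) ≡ pᵢ * aᵢ * (pⱼ * aⱼ) * (f * rᵢ * rⱼ * f)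
    regroupʳ = solve-∀

  hypergeometric-term : ∀ n i j t k → i < n → j < n →
    ℕ→ℚ (paths i t ℕ.* paths (n ∸ suc i) k ℕ.* (paths j t ℕ.* paths (n ∸ suc j) k)) ≡
    rhsPrefactor (suc (t ℕ.+ k)) (suc i) (suc j) ℚ.* rhsTerm (suc (t ℕ.+ k)) n (suc i) (suc j) k
  hypergeometric-term n i j t k i<n j<n = sym (begin
    ℤ→ℚ (+ cᵢ) ℚ.* ℤ→ℚ (+ cⱼ) ℚ.* rhsTerm (suc D) n (suc i) (suc j) k
      ≡⟨ cong₂ ℚ._*_ (ℤ→ℚ-* (+ cᵢ) (+ cⱼ)) (rhsTerm-ℤ n i j D k i<n j<n) ⟩
    ℤ→ℚ (+ cᵢ * + cⱼ) ℚ.* (ℤ→ℚ (aᵢ * f * (aⱼ * f) * r * r) ÷' ℤ→ℚ denominator)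
      ≡⟨ ℤ→ℚ-÷' (+ cᵢ * + cⱼ) (aᵢ * f * (aⱼ * f) * r * r) (+ g) denominator denominator≢0 cross-multiplied ⟩
    ℤ→ℚ (+ g) ∎)
    where
    open ≡-Reasoning
    D cᵢ cⱼ g : ℕ
    D = t ℕ.+ k
    cᵢ = ((suc i ℕ.+ suc D) ∸ 2) C D
    cⱼ = ((suc j ℕ.+ suc D) ∸ 2) C D
    g = paths i t ℕ.* paths (n ∸ suc i) k ℕ.* (paths j t ℕ.* paths (n ∸ suc j) k)
    aᵢ aⱼ f r rᵢ rⱼ denominator : ℤ
    aᵢ = + paths (n ∸ suc i) k
    aⱼ = + paths (n ∸ suc j) k
    f = + (k !)
    r = risingℤ (- + D) k
    rᵢ = risingℤ (- + (D ℕ.+ i)) k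
    rⱼ = risingℤ (- + (D ℕ.+ j)) k
    denominator = f * rᵢ * rⱼ * f
    denominator≢0 : denominator ≢ 0ℤ
    denominator≢0 = nonzero* (nonzero* (nonzero* f≢0 (risingℤ-neg≢0 (k≤D+ i))) (risingℤ-neg≢0 (k≤D+ j))) f≢0
      where
      f≢0 : f ≢ 0ℤ
      f≢0 eq = ℕ.<⇒≢ (ℕ.1≤n! k) (sym (ℤ.+-injective eq))
      nonzero* : ∀ {a b} → a ≢ 0ℤ → b ≢ 0ℤ → a * b ≢ 0ℤ
      nonzero* {a} a≢0 b≢0 eq = [ a≢0 , b≢0 ]′ (ℤ.i*j≡0⇒i≡0∨j≡0 a eq)
      k≤D+ : ∀ m → k ℕ.≤ D ℕ.+ m
      k≤D+ m = ℕ.≤-trans (ℕ.m≤n+m k t) (ℕ.m≤m+n D m)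
    cross-multiplied : + cᵢ * + cⱼ * (aᵢ * f * (aⱼ * f) * r * r) ≡ + g * denominator
    cross-multiplied = begin
      + cᵢ * + cⱼ * (aᵢ * f * (aⱼ * f) * r * r)
        ≡⟨ cong₂ (λ c c′ → + c * + c′ * (aᵢ * f * (aⱼ * f) * r * r)) (prefactor≡paths i D) (prefactor≡paths j D) ⟩
      + paths i D * + paths j D * (aᵢ * f * (aⱼ * f) * r * r)
        ≡⟨ exchange (+ paths i D) (+ paths j D) (+ paths i t) (+ paths j t) aᵢ aⱼ f r rᵢ rⱼ
             (paths*risingℤ-neg i t k) (paths*risingℤ-neg j t k) ⟩
      + paths i t * aᵢ * (+ paths j t * aⱼ) * denominator
        ≡⟨ cong (_* denominator) (trans (ℤ.pos-* (paths i t ℕ.* paths (n ∸ suc i) k) _)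
             (cong₂ _*_ (ℤ.pos-* (paths i t) _) (ℤ.pos-* (paths j t) _))) ⟨
      + g * denominator ∎

  sum-paths-products≡rhs : ∀ n i j D → i < n → j < n →
    ℕ→ℚ (sum (applyUpTo (λ t → paths i t ℕ.* paths (n ∸ suc i) (D ∸ t) ℕ.*
                               (paths j t ℕ.* paths (n ∸ suc j) (D ∸ t))) (suc D)))
    ≡ rhs (suc D) n (suc i) (suc j)
  sum-paths-products≡rhs n i j D i<n j<n = begin
    ℕ→ℚ (sum (applyUpTo g (suc D)))
      ≡⟨ cong ℕ→ℚ (sum-applyUpTo-reverse g (suc D)) ⟩
    ℕ→ℚ (sum (applyUpTo (λ k → g (D ∸ k)) (suc D)))
      ≡⟨ ℕ→ℚ-sum (applyUpTo (λ k → g (D ∸ k)) (suc D)) ⟩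
    foldr ℚ._+_ 0ℚ (map ℕ→ℚ (applyUpTo (λ k → g (D ∸ k)) (suc D)))
      ≡⟨ cong (foldr ℚ._+_ 0ℚ) (map-applyUpTo (λ k → g (D ∸ k)) ℕ→ℚ (suc D)) ⟩
    foldr ℚ._+_ 0ℚ (applyUpTo (λ k → ℕ→ℚ (g (D ∸ k))) (suc D))
      ≡⟨ cong (foldr ℚ._+_ 0ℚ) (applyUpTo-cong (suc D) (λ k k<1+D → reversed-term (ℕ.≤-pred k<1+D))) ⟩
    foldr ℚ._+_ 0ℚ (applyUpTo (λ k → c ℚ.* term k) (suc D))
      ≡⟨ cong (foldr ℚ._+_ 0ℚ) (map-applyUpTo term (c ℚ.*_) (suc D)) ⟨
    foldr ℚ._+_ 0ℚ (map (c ℚ.*_) (applyUpTo term (suc D)))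
      ≡⟨ *-distribˡ-foldr c (applyUpTo term (suc D)) ⟨
    c ℚ.* foldr ℚ._+_ 0ℚ (applyUpTo term (suc D))
      ≡⟨ cong (λ ts → c ℚ.* foldr ℚ._+_ 0ℚ ts) (map-applyUpTo (λ k → k) term (suc D)) ⟨
    rhs (suc D) n (suc i) (suc j) ∎
    where
    open ≡-Reasoning
    g : ℕ → ℕ
    g t = paths i t ℕ.* paths (n ∸ suc i) (D ∸ t) ℕ.* (paths j t ℕ.* paths (n ∸ suc j) (D ∸ t))
    c : ℚ
    c = rhsPrefactor (suc D) (suc i) (suc j)
    term : ℕ → ℚ
    term = rhsTerm (suc D) n (suc i) (suc j)
    reversed-term : ∀ {k} → k ℕ.≤ D → ℕ→ℚ (g (D ∸ k)) ≡ c ℚ.* term k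
    reversed-term {k} k≤D = subst₂
      (λ e D′ → ℕ→ℚ (paths i (D ∸ k) ℕ.* paths (n ∸ suc i) e ℕ.* (paths j (D ∸ k) ℕ.* paths (n ∸ suc j) e)) ≡
                rhsPrefactor (suc D′) (suc i) (suc j) ℚ.* rhsTerm (suc D′) n (suc i) (suc j) k)
      (sym (ℕ.m∸[m∸n]≡n k≤D)) (ℕ.m∸n+n≡m k≤D) (hypergeometric-term n i j (D ∸ k) k i<n j<n)

open import Data.Nat using (_*_; _∸_)
open import Data.List using (applyUpTo)
open Sums using (sum-map-Unique-cong)
open Binomials using (paths)
open Multichains using (multichains; multichains-Unique; ∈-multichains⇔InT)
open EntrySums using (sum-entry-multichains-zero)
open HypergeometricTerm using (sum-paths-products≡rhs)

theorem3p2 : (n d : ℕ) → n ≥ 1 → d ≥ 1 → (L : List (Mat n)) → Unique L →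
    (∀ (M : Mat n) → (M ∈ L) ⇔ InT d n M) →
    (i j : Fin n) →
    ℕ→ℚ (sum (map (λ T → entry T i j) L)) ≡ rhs d n (suc (toℕ i)) (suc (toℕ j))
theorem3p2 (suc n) (suc D) _ _ L L! L≈𝒯 i j = begin
  ℕ→ℚ (sum (map entryᵢⱼ L))
    ≡⟨ cong ℕ→ℚ (sum-map-Unique-cong entryᵢⱼ L! (multichains-Unique (suc D) zero zero) same-members) ⟩
  ℕ→ℚ (sum (map entryᵢⱼ (multichains (suc D) zero zero)))
    ≡⟨ cong ℕ→ℚ (sum-entry-multichains-zero i j (suc D)) ⟩
  ℕ→ℚ (sum (applyUpTo (λ t → paths (toℕ i) t * paths (n ∸ toℕ i) (D ∸ t) *
                             (paths (toℕ j) t * paths (n ∸ toℕ j) (D ∸ t))) (suc D)))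
    ≡⟨ sum-paths-products≡rhs (suc n) (toℕ i) (toℕ j) D (Fin.toℕ<n i) (Fin.toℕ<n j) ⟩
  rhs (suc D) (suc n) (suc (toℕ i)) (suc (toℕ j)) ∎
  where
  open ≡-Reasoning
  entryᵢⱼ : Mat (suc n) → ℕ
  entryᵢⱼ T = entry T i j
  same-members : ∀ M → (M ∈ L) ⇔ (M ∈ multichains (suc D) zero zero)
  same-members M = ⇔.trans (L≈𝒯 M) (⇔.sym (∈-multichains⇔InT (suc D) M))
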